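{- If $A$ is an MV-algebra in the variety $V(C)$, then $\theta(A)$ is closed under $\oplus$, $\odot$, $\wedge$ and $\vee$.
   Context: An MV-algebra is a structure $(A,\oplus,\neg,0)$ where $(A,\oplus,0)$ is a commutative monoid, $\neg\neg x=x$, $x\oplus \neg 0=\neg 0$, and $\neg(\neg x\oplus y)\oplus y=\neg(\neg y\oplus x)\oplus x$; put $1=\neg 0$, $x\odot y=\neg(\neg x\oplus\neg y)$, $2x=x\oplus x$, $x^2=x\odot x$; $A$ is a lattice under $x\le y$ iff $y=x\oplus z$ for some $z$, with meet $\wedge$ and join $\vee$. $V(C)$ is the variety of MV-algebras generated by Chang's algebra $C=\Gamma(\mathbb Z\times_{lex}\mathbb Z,(1,0))$, axiomatized relative to MV-algebras by $(2x)^2=2(x^2)$. $\theta(A)=\{x\in A: x\ge 2x^2\}$. -}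

module Defs where

open import Level using (Level; suc; _⊔_)
open import Relation.Binary.PropositionalEquality using (_≡_)
open import Data.Product using (Σ)

record MVAlgebra (a : Level) : Set (suc a) where
  field
    Carrier : Set a
    _⊕_     : Carrier → Carrier → Carrier
    ¬_      : Carrier → Carrier
    𝟘       : Carrier
    ⊕-assoc    : ∀ x y z → (x ⊕ y) ⊕ z ≡ x ⊕ (y ⊕ z)
    ⊕-comm     : ∀ x y → x ⊕ y ≡ y ⊕ x
    ⊕-identityʳ : ∀ x → x ⊕ 𝟘 ≡ x
    ¬-involutive : ∀ x → ¬ (¬ x) ≡ x
    ⊕-absorb   : ∀ x → x ⊕ (¬ 𝟘) ≡ ¬ 𝟘
    łukasiewicz : ∀ x y → (¬ ((¬ x) ⊕ y)) ⊕ y ≡ (¬ ((¬ y) ⊕ x)) ⊕ x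

  infixl 6 _⊕_
  infixl 7 _⊙_
  infix 4 _≤_

  𝟙 : Carrier
  𝟙 = ¬ 𝟘

  _⊙_ : Carrier → Carrier → Carrier
  x ⊙ y = ¬ ((¬ x) ⊕ (¬ y))

  twice : Carrier → Carrier
  twice x = x ⊕ x

  sq : Carrier → Carrier
  sq x = x ⊙ x

  _≤_ : Carrier → Carrier → Set a
  x ≤ y = Σ Carrier (λ z → y ≡ x ⊕ z)

  _∨_ : Carrier → Carrier → Carrier
  x ∨ y = (¬ ((¬ x) ⊕ y)) ⊕ y

  _∧_ : Carrier → Carrier → Carrier
  x ∧ y = ¬ ((¬ x) ∨ (¬ y))

  θ : Carrier → Set a
  θ x = twice (sq x) ≤ x

InVC : ∀ {a} → MVAlgebra a → Set a
InVC A = ∀ x → sq (twice x) ≡ twice (sq x)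
  where open MVAlgebra A

{-# OPTIONS --safe #-}
-- In V(C) the element 2x² is Boolean: ¬(2x²) = (2¬x)² = 2(¬x)², and 2x² ∧ 2(¬x)² = 0
-- because x² ∧ (¬x)² = 0 in every MV-algebra.  So x ↦ 2x² is monotone and
-- ⊙-idempotent, which gives closure under ⊙ and ∧.  For ⊕, split 2x = 2x² ⊕ r with
-- r² = 0; in V(C) such r are closed under ⊕, and (e ⊕ t)² ≤ e ⊕ t² for Boolean e, so
-- 2(x ⊕ y)² = (2x ⊕ 2y)² ≤ 2x² ⊕ 2y².  For ∨, combine this with x ∨ y ≤ x ⊕ y and
-- e ⊕ f ≤ e ∨ f for Boolean e.
module Submission where

open import Defs
open import Level using (Level)
open import Data.Product using (Σ-syntax; _×_; _,_)
open import Relation.Binary.PropositionalEquality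
  using (_≡_; refl; sym; trans; cong; cong₂; subst; isEquivalence; module ≡-Reasoning)
open import Relation.Binary.Structures using (IsPreorder)
open import Algebra.Bundles using (CommutativeSemigroup)
import Algebra.Properties.CommutativeSemigroup as CommutativeSemigroupProperties
import Relation.Binary.Reasoning.Base.Double as PreorderReasoning

module MVAlgebraProperties {a : Level} (A : MVAlgebra a) where
  open MVAlgebra A

  ⊕-commutativeSemigroup : CommutativeSemigroup a a
  ⊕-commutativeSemigroup = record
    { _≈_ = _≡_
    ; _∙_ = _⊕_
    ; isCommutativeSemigroup = record
      { isSemigroup = record
        { isMagma = record { isEquivalence = isEquivalence ; ∙-cong = cong₂ _⊕_ }
        ; assoc = ⊕-assoc
        }
      ; comm = ⊕-comm
      }
    }

  open CommutativeSemigroupProperties ⊕-commutativeSemigroup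
    using (x∙yz≈y∙xz)

  ⊕-identityˡ : ∀ x → 𝟘 ⊕ x ≡ x
  ⊕-identityˡ x = trans (⊕-comm 𝟘 x) (⊕-identityʳ x)

  ⊕-zeroˡ : ∀ x → 𝟙 ⊕ x ≡ 𝟙
  ⊕-zeroˡ x = trans (⊕-comm 𝟙 x) (⊕-absorb x)

  ¬-injective : ∀ {x y} → ¬ x ≡ ¬ y → x ≡ y
  ¬-injective {x} {y} ¬x≡¬y = trans (sym (¬-involutive x)) (trans (cong ¬_ ¬x≡¬y) (¬-involutive y))

  ¬𝟙≡𝟘 : ¬ 𝟙 ≡ 𝟘
  ¬𝟙≡𝟘 = ¬-involutive 𝟘

  ¬[x⊕y]≡¬x⊙¬y : ∀ x y → ¬ (x ⊕ y) ≡ ¬ x ⊙ ¬ y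
  ¬[x⊕y]≡¬x⊙¬y x y = sym (cong ¬_ (cong₂ _⊕_ (¬-involutive x) (¬-involutive y)))

  ¬x⊕x≡𝟙 : ∀ x → ¬ x ⊕ x ≡ 𝟙
  ¬x⊕x≡𝟙 x = begin
    ¬ x ⊕ x               ≡⟨ cong (λ t → ¬ t ⊕ x) (⊕-identityˡ x) ⟨
    ¬ (𝟘 ⊕ x) ⊕ x         ≡⟨ cong (λ t → ¬ (t ⊕ x) ⊕ x) ¬𝟙≡𝟘 ⟨
    ¬ (¬ 𝟙 ⊕ x) ⊕ x       ≡⟨ łukasiewicz x 𝟙 ⟨
    ¬ (¬ x ⊕ 𝟙) ⊕ 𝟙       ≡⟨ ⊕-absorb _ ⟩
    𝟙                     ∎
    where open ≡-Reasoning

  x⊕¬x≡𝟙 : ∀ x → x ⊕ ¬ x ≡ 𝟙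
  x⊕¬x≡𝟙 x = trans (⊕-comm x (¬ x)) (¬x⊕x≡𝟙 x)

  ⊙-comm : ∀ x y → x ⊙ y ≡ y ⊙ x
  ⊙-comm x y = cong ¬_ (⊕-comm (¬ x) (¬ y))

  ⊙-identityʳ : ∀ x → x ⊙ 𝟙 ≡ x
  ⊙-identityʳ x = begin
    ¬ (¬ x ⊕ ¬ 𝟙)     ≡⟨ cong (λ t → ¬ (¬ x ⊕ t)) ¬𝟙≡𝟘 ⟩
    ¬ (¬ x ⊕ 𝟘)       ≡⟨ cong ¬_ (⊕-identityʳ (¬ x)) ⟩
    ¬ ¬ x             ≡⟨ ¬-involutive x ⟩
    x                 ∎
    where open ≡-Reasoning

  ≤⇒¬x⊕y≡𝟙 : ∀ {x y} → x ≤ y → ¬ x ⊕ y ≡ 𝟙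
  ≤⇒¬x⊕y≡𝟙 {x} {y} (z , y≡x⊕z) = begin
    ¬ x ⊕ y           ≡⟨ cong (¬ x ⊕_) y≡x⊕z ⟩
    ¬ x ⊕ (x ⊕ z)     ≡⟨ ⊕-assoc _ _ _ ⟨
    (¬ x ⊕ x) ⊕ z     ≡⟨ cong (_⊕ z) (¬x⊕x≡𝟙 x) ⟩
    𝟙 ⊕ z             ≡⟨ ⊕-zeroˡ z ⟩
    𝟙                 ∎
    where open ≡-Reasoning

  ¬x⊕y≡𝟙⇒x∨y≡y : ∀ {x y} → ¬ x ⊕ y ≡ 𝟙 → x ∨ y ≡ y
  ¬x⊕y≡𝟙⇒x∨y≡y {x} {y} eq =
    trans (cong (λ t → ¬ t ⊕ y) eq) (trans (cong (_⊕ y) ¬𝟙≡𝟘) (⊕-identityˡ y))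

  ¬x⊕y≡𝟙⇒≤ : ∀ {x y} → ¬ x ⊕ y ≡ 𝟙 → x ≤ y
  ¬x⊕y≡𝟙⇒≤ {x} {y} eq = ¬ (¬ y ⊕ x) , (begin
    y                 ≡⟨ ¬x⊕y≡𝟙⇒x∨y≡y eq ⟨
    ¬ (¬ x ⊕ y) ⊕ y   ≡⟨ łukasiewicz x y ⟩
    ¬ (¬ y ⊕ x) ⊕ x   ≡⟨ ⊕-comm _ _ ⟩
    x ⊕ ¬ (¬ y ⊕ x)   ∎)
    where open ≡-Reasoning

  x≤y⇒x∨y≡y : ∀ {x y} → x ≤ y → x ∨ y ≡ y
  x≤y⇒x∨y≡y x≤y = ¬x⊕y≡𝟙⇒x∨y≡y (≤⇒¬x⊕y≡𝟙 x≤y)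

  ≤-refl : ∀ {x} → x ≤ x
  ≤-refl {x} = 𝟘 , sym (⊕-identityʳ x)

  ≤-reflexive : ∀ {x y} → x ≡ y → x ≤ y
  ≤-reflexive refl = ≤-refl

  ≤-trans : ∀ {x y z} → x ≤ y → y ≤ z → x ≤ z
  ≤-trans {x} (u , y≡x⊕u) (v , z≡y⊕v) =
    u ⊕ v , trans z≡y⊕v (trans (cong (_⊕ v) y≡x⊕u) (⊕-assoc x u v))

  ≤-antisym : ∀ {x y} → x ≤ y → y ≤ x → x ≡ y
  ≤-antisym {x} {y} x≤y y≤x = begin
    x                 ≡⟨ x≤y⇒x∨y≡y y≤x ⟨
    ¬ (¬ y ⊕ x) ⊕ x   ≡⟨ łukasiewicz x y ⟨
    ¬ (¬ x ⊕ y) ⊕ y   ≡⟨ x≤y⇒x∨y≡y x≤y ⟩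
    y                 ∎
    where open ≡-Reasoning

  ≤-isPreorder : IsPreorder _≡_ _≤_
  ≤-isPreorder = record
    { isEquivalence = isEquivalence
    ; reflexive = ≤-reflexive
    ; trans = ≤-trans
    }

  module ≤-Reasoning = PreorderReasoning ≤-isPreorder

  x⊙¬y≡𝟘⇒x≤y : ∀ {x y} → x ⊙ ¬ y ≡ 𝟘 → x ≤ y
  x⊙¬y≡𝟘⇒x≤y {x} {y} eq = ¬x⊕y≡𝟙⇒≤ (begin
    ¬ x ⊕ y           ≡⟨ cong (¬ x ⊕_) (¬-involutive y) ⟨
    ¬ x ⊕ ¬ ¬ y       ≡⟨ ¬-involutive _ ⟨
    ¬ (x ⊙ ¬ y)       ≡⟨ cong ¬_ eq ⟩
    𝟙                 ∎)
    where open ≡-Reasoning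

  x≤y⇒x⊙¬y≡𝟘 : ∀ {x y} → x ≤ y → x ⊙ ¬ y ≡ 𝟘
  x≤y⇒x⊙¬y≡𝟘 {x} {y} x≤y = begin
    ¬ (¬ x ⊕ ¬ ¬ y)   ≡⟨ cong (λ t → ¬ (¬ x ⊕ t)) (¬-involutive y) ⟩
    ¬ (¬ x ⊕ y)       ≡⟨ cong ¬_ (≤⇒¬x⊕y≡𝟙 x≤y) ⟩
    ¬ 𝟙               ≡⟨ ¬𝟙≡𝟘 ⟩
    𝟘                 ∎
    where open ≡-Reasoning

  ¬-antimono-≤ : ∀ {x y} → x ≤ y → ¬ y ≤ ¬ x
  ¬-antimono-≤ {x} {y} x≤y = ¬x⊕y≡𝟙⇒≤ (begin
    ¬ ¬ y ⊕ ¬ x       ≡⟨ cong (_⊕ ¬ x) (¬-involutive y) ⟩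
    y ⊕ ¬ x           ≡⟨ ⊕-comm y (¬ x) ⟩
    ¬ x ⊕ y           ≡⟨ ≤⇒¬x⊕y≡𝟙 x≤y ⟩
    𝟙                 ∎)
    where open ≡-Reasoning

  x≤¬y⇒y≤¬x : ∀ {x y} → x ≤ ¬ y → y ≤ ¬ x
  x≤¬y⇒y≤¬x {x} {y} x≤¬y = subst (_≤ ¬ x) (¬-involutive y) (¬-antimono-≤ x≤¬y)

  ⊕-monoˡ-≤ : ∀ {x y} z → x ≤ y → x ⊕ z ≤ y ⊕ z
  ⊕-monoˡ-≤ {x} {y} z (u , y≡x⊕u) = u , (begin
    y ⊕ z             ≡⟨ cong (_⊕ z) y≡x⊕u ⟩
    (x ⊕ u) ⊕ z       ≡⟨ ⊕-assoc x u z ⟩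
    x ⊕ (u ⊕ z)       ≡⟨ cong (x ⊕_) (⊕-comm u z) ⟩
    x ⊕ (z ⊕ u)       ≡⟨ ⊕-assoc x z u ⟨
    (x ⊕ z) ⊕ u       ∎)
    where open ≡-Reasoning

  ⊕-monoʳ-≤ : ∀ {x y} z → x ≤ y → z ⊕ x ≤ z ⊕ y
  ⊕-monoʳ-≤ {x} z (u , y≡x⊕u) = u , trans (cong (z ⊕_) y≡x⊕u) (sym (⊕-assoc z x u))

  ⊕-mono-≤ : ∀ {x y u v} → x ≤ y → u ≤ v → x ⊕ u ≤ y ⊕ v
  ⊕-mono-≤ {y = y} {u = u} x≤y u≤v = ≤-trans (⊕-monoˡ-≤ u x≤y) (⊕-monoʳ-≤ y u≤v)

  ⊙-monoˡ-≤ : ∀ {x y} z → x ≤ y → x ⊙ z ≤ y ⊙ z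
  ⊙-monoˡ-≤ z x≤y = ¬-antimono-≤ (⊕-monoˡ-≤ (¬ z) (¬-antimono-≤ x≤y))

  ⊙-monoʳ-≤ : ∀ {x y} z → x ≤ y → z ⊙ x ≤ z ⊙ y
  ⊙-monoʳ-≤ z x≤y = ¬-antimono-≤ (⊕-monoʳ-≤ (¬ z) (¬-antimono-≤ x≤y))

  ⊙-mono-≤ : ∀ {x y u v} → x ≤ y → u ≤ v → x ⊙ u ≤ y ⊙ v
  ⊙-mono-≤ {y = y} {u = u} x≤y u≤v = ≤-trans (⊙-monoˡ-≤ u x≤y) (⊙-monoʳ-≤ y u≤v)

  sq-mono-≤ : ∀ {x y} → x ≤ y → sq x ≤ sq y
  sq-mono-≤ x≤y = ⊙-mono-≤ x≤y x≤y

  twice-mono-≤ : ∀ {x y} → x ≤ y → twice x ≤ twice y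
  twice-mono-≤ x≤y = ⊕-mono-≤ x≤y x≤y

  x≤𝟙 : ∀ {x} → x ≤ 𝟙
  x≤𝟙 {x} = ¬x⊕y≡𝟙⇒≤ (⊕-absorb (¬ x))

  𝟘≤x : ∀ {x} → 𝟘 ≤ x
  𝟘≤x {x} = x , sym (⊕-identityˡ x)

  x≤𝟘⇒x≡𝟘 : ∀ {x} → x ≤ 𝟘 → x ≡ 𝟘
  x≤𝟘⇒x≡𝟘 x≤𝟘 = ≤-antisym x≤𝟘 𝟘≤x

  x⊙y≤x : ∀ {x y} → x ⊙ y ≤ x
  x⊙y≤x {x} {y} = subst (x ⊙ y ≤_) (⊙-identityʳ x) (⊙-monoʳ-≤ x x≤𝟙)

  x⊙y≤y : ∀ {x y} → x ⊙ y ≤ y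
  x⊙y≤y {x} {y} = subst (_≤ y) (⊙-comm y x) x⊙y≤x

  x≤x⊕y : ∀ {x y} → x ≤ x ⊕ y
  x≤x⊕y {y = y} = y , refl

  y≤x⊕y : ∀ {x y} → y ≤ x ⊕ y
  y≤x⊕y {x} {y} = x , ⊕-comm x y

  ∨-comm : ∀ x y → x ∨ y ≡ y ∨ x
  ∨-comm = łukasiewicz

  y≤x∨y : ∀ {x y} → y ≤ x ∨ y
  y≤x∨y {x} {y} = ¬ (¬ x ⊕ y) , ⊕-comm _ _

  x≤x∨y : ∀ {x y} → x ≤ x ∨ y
  x≤x∨y {x} {y} = subst (x ≤_) (∨-comm y x) y≤x∨y

  ∨-lub : ∀ {x y z} → x ≤ z → y ≤ z → x ∨ y ≤ z
  ∨-lub {x} {y} {z} x≤z y≤z = begin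
    ¬ (¬ x ⊕ y) ⊕ y   ≲⟨ ⊕-monoˡ-≤ y (¬-antimono-≤ (⊕-monoˡ-≤ y (¬-antimono-≤ x≤z))) ⟩
    z ∨ y             ≡⟨ ∨-comm z y ⟩
    y ∨ z             ≡⟨ x≤y⇒x∨y≡y y≤z ⟩
    z                 ∎
    where open ≤-Reasoning

  ∨-mono-≤ : ∀ {x y u v} → x ≤ y → u ≤ v → x ∨ u ≤ y ∨ v
  ∨-mono-≤ x≤y u≤v = ∨-lub (≤-trans x≤y x≤x∨y) (≤-trans u≤v y≤x∨y)

  x∨y≤x⊕y : ∀ {x y} → x ∨ y ≤ x ⊕ y
  x∨y≤x⊕y {x} {y} = ⊕-monoˡ-≤ y (subst (¬ (¬ x ⊕ y) ≤_) (¬-involutive x) (¬-antimono-≤ x≤x⊕y))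

  x∧y≤x : ∀ {x y} → x ∧ y ≤ x
  x∧y≤x {x} {y} = subst (x ∧ y ≤_) (¬-involutive x) (¬-antimono-≤ (x≤x∨y {¬ x} {¬ y}))

  x∧y≤y : ∀ {x y} → x ∧ y ≤ y
  x∧y≤y {x} {y} = subst (x ∧ y ≤_) (¬-involutive y) (¬-antimono-≤ (y≤x∨y {¬ x} {¬ y}))

  ∧-glb : ∀ {x y z} → z ≤ x → z ≤ y → z ≤ x ∧ y
  ∧-glb {x} {y} {z} z≤x z≤y =
    subst (_≤ x ∧ y) (¬-involutive z) (¬-antimono-≤ (∨-lub (¬-antimono-≤ z≤x) (¬-antimono-≤ z≤y)))

  ∧-comm : ∀ x y → x ∧ y ≡ y ∧ x
  ∧-comm x y = cong ¬_ (∨-comm (¬ x) (¬ y))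

  x∧y≡[x⊕¬y]⊙y : ∀ x y → x ∧ y ≡ (x ⊕ ¬ y) ⊙ y
  x∧y≡[x⊕¬y]⊙y x y = cong (λ t → ¬ (¬ (t ⊕ ¬ y) ⊕ ¬ y)) (¬-involutive x)

  x⊙y≤z⇒x≤¬y⊕z : ∀ {x y z} → x ⊙ y ≤ z → x ≤ ¬ y ⊕ z
  x⊙y≤z⇒x≤¬y⊕z {x} {y} {z} x⊙y≤z = ¬x⊕y≡𝟙⇒≤ (begin
    ¬ x ⊕ (¬ y ⊕ z)   ≡⟨ ⊕-assoc _ _ _ ⟨
    (¬ x ⊕ ¬ y) ⊕ z   ≡⟨ cong (_⊕ z) (¬-involutive _) ⟨
    ¬ (x ⊙ y) ⊕ z     ≡⟨ ≤⇒¬x⊕y≡𝟙 x⊙y≤z ⟩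
    𝟙                 ∎)
    where open ≡-Reasoning

  x≤¬y⊕z⇒x⊙y≤z : ∀ {x y z} → x ≤ ¬ y ⊕ z → x ⊙ y ≤ z
  x≤¬y⊕z⇒x⊙y≤z {x} {y} {z} x≤¬y⊕z = ¬x⊕y≡𝟙⇒≤ (begin
    ¬ (x ⊙ y) ⊕ z     ≡⟨ cong (_⊕ z) (¬-involutive _) ⟩
    (¬ x ⊕ ¬ y) ⊕ z   ≡⟨ ⊕-assoc _ _ _ ⟩
    ¬ x ⊕ (¬ y ⊕ z)   ≡⟨ ≤⇒¬x⊕y≡𝟙 x≤¬y⊕z ⟩
    𝟙                 ∎)
    where open ≡-Reasoning

  x²≡𝟘⇒x≤¬x : ∀ {x} → sq x ≡ 𝟘 → x ≤ ¬ x
  x²≡𝟘⇒x≤¬x {x} eq = x⊙¬y≡𝟘⇒x≤y (trans (cong (x ⊙_) (¬-involutive x)) eq)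

  x≤¬x⇒x²≡𝟘 : ∀ {x} → x ≤ ¬ x → sq x ≡ 𝟘
  x≤¬x⇒x²≡𝟘 {x} x≤¬x = trans (cong (x ⊙_) (sym (¬-involutive x))) (x≤y⇒x⊙¬y≡𝟘 x≤¬x)

  2x²-mono-≤ : ∀ {x y} → x ≤ y → twice (sq x) ≤ twice (sq y)
  2x²-mono-≤ x≤y = twice-mono-≤ (sq-mono-≤ x≤y)

  x⊙[y⊕z]≤x⊙y⊕z : ∀ x y z → x ⊙ (y ⊕ z) ≤ x ⊙ y ⊕ z
  x⊙[y⊕z]≤x⊙y⊕z x y z = x≤¬y⊕z⇒x⊙y≤z (begin
    x                          ≲⟨ x≤x∨y ⟩
    x ∨ (¬ y)                  ≡⟨⟩
    x ⊙ y ⊕ ¬ y                ≲⟨ ⊕-monoʳ-≤ (x ⊙ y) ¬y≤¬[y⊕z]⊕z ⟩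
    x ⊙ y ⊕ (¬ (y ⊕ z) ⊕ z)    ≡⟨ x∙yz≈y∙xz _ _ _ ⟩
    ¬ (y ⊕ z) ⊕ (x ⊙ y ⊕ z)    ∎)
    where
    open ≤-Reasoning
    ¬y≤¬[y⊕z]⊕z : ¬ y ≤ ¬ (y ⊕ z) ⊕ z
    ¬y≤¬[y⊕z]⊕z = subst (λ t → ¬ y ≤ ¬ (t ⊕ z) ⊕ z) (¬-involutive y) x≤x∨y

  [x⊕y]⊙¬x≤y : ∀ x y → (x ⊕ y) ⊙ ¬ x ≤ y
  [x⊕y]⊙¬x≤y x y = x≤¬y⊕z⇒x⊙y≤z (≤-reflexive (cong (_⊕ y) (sym (¬-involutive x))))

  [x⊕y]∧[x⊕z]≤x⊕[y∧z] : ∀ x y z → (x ⊕ y) ∧ (x ⊕ z) ≤ x ⊕ (y ∧ z)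
  [x⊕y]∧[x⊕z]≤x⊕[y∧z] x y z =
    subst (λ t → (x ⊕ y) ∧ (x ⊕ z) ≤ t ⊕ (y ∧ z)) (¬-involutive x)
      (x⊙y≤z⇒x≤¬y⊕z (∧-glb (≤-trans (⊙-monoˡ-≤ (¬ x) x∧y≤x) ([x⊕y]⊙¬x≤y x y))
                            (≤-trans (⊙-monoˡ-≤ (¬ x) x∧y≤y) ([x⊕y]⊙¬x≤y x z))))

  [x⊕y]∧z≤x⊕[y∧z] : ∀ x y z → (x ⊕ y) ∧ z ≤ x ⊕ (y ∧ z)
  [x⊕y]∧z≤x⊕[y∧z] x y z =
    ≤-trans (∧-glb x∧y≤x (≤-trans x∧y≤y y≤x⊕y)) ([x⊕y]∧[x⊕z]≤x⊕[y∧z] x y z)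

  [x∧y]⊕[x⊙¬y]≡x : ∀ x y → x ∧ y ⊕ x ⊙ ¬ y ≡ x
  [x∧y]⊕[x⊙¬y]≡x x y = begin
    x ∧ y ⊕ x ⊙ ¬ y                ≡⟨ cong (_⊕ x ⊙ ¬ y) x∧y≡¬[¬x⊕x⊙¬y] ⟩
    x ∨ (x ⊙ ¬ y)                  ≡⟨ ∨-comm x (x ⊙ ¬ y) ⟩
    (x ⊙ ¬ y) ∨ x                  ≡⟨ x≤y⇒x∨y≡y x⊙y≤x ⟩
    x                              ∎
    where
    open ≡-Reasoning
    x∧y≡¬[¬x⊕x⊙¬y] : x ∧ y ≡ ¬ (¬ x ⊕ x ⊙ ¬ y)
    x∧y≡¬[¬x⊕x⊙¬y] = begin
      x ∧ y                        ≡⟨ cong ¬_ (∨-comm (¬ x) (¬ y)) ⟩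
      ¬ (¬ (¬ ¬ y ⊕ ¬ x) ⊕ ¬ x)    ≡⟨ cong (λ t → ¬ (¬ t ⊕ ¬ x)) (⊕-comm (¬ ¬ y) (¬ x)) ⟩
      ¬ (x ⊙ ¬ y ⊕ ¬ x)            ≡⟨ cong ¬_ (⊕-comm _ _) ⟩
      ¬ (¬ x ⊕ x ⊙ ¬ y)            ∎

  [x⊙y]⊕[x⊕y]≤x⊕y : ∀ x y → x ⊙ y ⊕ (x ⊕ y) ≤ x ⊕ y
  [x⊙y]⊕[x⊕y]≤x⊕y x y = begin
    x ⊙ y ⊕ (x ⊕ y)                ≲⟨ ⊕-monoʳ-≤ (x ⊙ y) x⊕y≤x⊕[y∧¬x] ⟩
    x ⊙ y ⊕ (x ⊕ (y ∧ (¬ x)))      ≡⟨ x∙yz≈y∙xz _ _ _ ⟩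
    x ⊕ (x ⊙ y ⊕ y ∧ (¬ x))        ≡⟨ cong (x ⊕_) (⊕-comm _ _) ⟩
    x ⊕ (y ∧ (¬ x) ⊕ x ⊙ y)        ≡⟨ cong (λ t → x ⊕ (y ∧ (¬ x) ⊕ t)) x⊙y≡y⊙¬¬x ⟩
    x ⊕ (y ∧ (¬ x) ⊕ y ⊙ ¬ ¬ x)    ≡⟨ cong (x ⊕_) ([x∧y]⊕[x⊙¬y]≡x y (¬ x)) ⟩
    x ⊕ y                          ∎
    where
    open ≤-Reasoning
    x⊕y≤x⊕[y∧¬x] : x ⊕ y ≤ x ⊕ (y ∧ (¬ x))
    x⊕y≤x⊕[y∧¬x] = ≤-trans (∧-glb ≤-refl (subst (x ⊕ y ≤_) (sym (x⊕¬x≡𝟙 x)) x≤𝟙))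
                           ([x⊕y]∧[x⊕z]≤x⊕[y∧z] x y (¬ x))
    x⊙y≡y⊙¬¬x : x ⊙ y ≡ y ⊙ ¬ ¬ x
    x⊙y≡y⊙¬¬x = trans (⊙-comm x y) (cong (y ⊙_) (sym (¬-involutive x)))

  x≤¬y⇒x⊕y≤y⇒x≡𝟘 : ∀ {x y} → x ≤ ¬ y → x ⊕ y ≤ y → x ≡ 𝟘
  x≤¬y⇒x⊕y≤y⇒x≡𝟘 {x} {y} x≤¬y x⊕y≤y = ¬-injective (begin
    ¬ x                            ≡⟨ x≤y⇒x∨y≡y (x≤¬y⇒y≤¬x x≤¬y) ⟨
    y ∨ (¬ x)                      ≡⟨ ∨-comm y (¬ x) ⟩
    (¬ x) ∨ y                      ≡⟨ cong (λ t → ¬ (t ⊕ y) ⊕ y) (¬-involutive x) ⟩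
    ¬ (x ⊕ y) ⊕ y                  ≡⟨ ≤⇒¬x⊕y≡𝟙 x⊕y≤y ⟩
    𝟙                              ∎)
    where open ≡-Reasoning

  [x⊙y]∧[¬x⊙¬y]≡𝟘 : ∀ x y → (x ⊙ y) ∧ (¬ x ⊙ ¬ y) ≡ 𝟘
  [x⊙y]∧[¬x⊙¬y]≡𝟘 x y = x≤¬y⇒x⊕y≤y⇒x≡𝟘
    (subst ((x ⊙ y) ∧ (¬ x ⊙ ¬ y) ≤_) (sym (¬[x⊕y]≡¬x⊙¬y x y)) x∧y≤y)
    (≤-trans (⊕-monoˡ-≤ (x ⊕ y) x∧y≤x) ([x⊙y]⊕[x⊕y]≤x⊕y x y))

  x∧y≡𝟘⇒2x∧y≡𝟘 : ∀ {x y} → x ∧ y ≡ 𝟘 → twice x ∧ y ≡ 𝟘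
  x∧y≡𝟘⇒2x∧y≡𝟘 {x} {y} x∧y≡𝟘 = x≤𝟘⇒x≡𝟘 (≤-trans (∧-glb 2x∧y≤x x∧y≤y) (≤-reflexive x∧y≡𝟘))
    where
    2x∧y≤x : twice x ∧ y ≤ x
    2x∧y≤x = ≤-trans ([x⊕y]∧z≤x⊕[y∧z] x x y)
                     (≤-reflexive (trans (cong (x ⊕_) x∧y≡𝟘) (⊕-identityʳ x)))

  x∧y≡𝟘⇒2x∧2y≡𝟘 : ∀ {x y} → x ∧ y ≡ 𝟘 → twice x ∧ twice y ≡ 𝟘
  x∧y≡𝟘⇒2x∧2y≡𝟘 {x} {y} x∧y≡𝟘 =
    trans (∧-comm (twice x) (twice y))
          (x∧y≡𝟘⇒2x∧y≡𝟘 (trans (∧-comm y (twice x)) (x∧y≡𝟘⇒2x∧y≡𝟘 x∧y≡𝟘)))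

  x∧¬x≡𝟘⇒x²≡x : ∀ {x} → x ∧ (¬ x) ≡ 𝟘 → sq x ≡ x
  x∧¬x≡𝟘⇒x²≡x {x} x∧¬x≡𝟘 = ≤-antisym x⊙y≤x (x⊙¬y≡𝟘⇒x≤y (begin
    x ⊙ ¬ (x ⊙ x)                  ≡⟨ cong (x ⊙_) (¬-involutive _) ⟩
    x ⊙ (¬ x ⊕ ¬ x)                ≡⟨ ⊙-comm _ _ ⟩
    (¬ x ⊕ ¬ x) ⊙ x                ≡⟨ x∧y≡[x⊕¬y]⊙y (¬ x) x ⟨
    (¬ x) ∧ x                      ≡⟨ ∧-comm _ _ ⟩
    x ∧ (¬ x)                      ≡⟨ x∧¬x≡𝟘 ⟩
    𝟘                              ∎))
    where open ≡-Reasoning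

  x∧¬x≡𝟘⇒2x≡x : ∀ {x} → x ∧ (¬ x) ≡ 𝟘 → twice x ≡ x
  x∧¬x≡𝟘⇒2x≡x {x} x∧¬x≡𝟘 = ¬-injective (trans (¬[x⊕y]≡¬x⊙¬y x x) (x∧¬x≡𝟘⇒x²≡x ¬x∧¬¬x≡𝟘))
    where
    ¬x∧¬¬x≡𝟘 : (¬ x) ∧ (¬ ¬ x) ≡ 𝟘
    ¬x∧¬¬x≡𝟘 = trans (cong ((¬ x) ∧_) (¬-involutive x)) (trans (∧-comm (¬ x) x) x∧¬x≡𝟘)

  2e≡e⇒[e⊕x]²≤e⊕x² : ∀ {e} x → twice e ≡ e → sq (e ⊕ x) ≤ e ⊕ sq x
  2e≡e⇒[e⊕x]²≤e⊕x² {e} x 2e≡e = begin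
    (e ⊕ x) ⊙ (e ⊕ x)              ≡⟨ cong ((e ⊕ x) ⊙_) (⊕-comm e x) ⟩
    (e ⊕ x) ⊙ (x ⊕ e)              ≲⟨ x⊙[y⊕z]≤x⊙y⊕z (e ⊕ x) x e ⟩
    (e ⊕ x) ⊙ x ⊕ e                ≡⟨ cong (_⊕ e) (⊙-comm (e ⊕ x) x) ⟩
    x ⊙ (e ⊕ x) ⊕ e                ≡⟨ cong (λ t → x ⊙ t ⊕ e) (⊕-comm e x) ⟩
    x ⊙ (x ⊕ e) ⊕ e                ≲⟨ ⊕-monoˡ-≤ e (x⊙[y⊕z]≤x⊙y⊕z x x e) ⟩
    x ⊙ x ⊕ e ⊕ e                  ≡⟨ ⊕-assoc (x ⊙ x) e e ⟩
    x ⊙ x ⊕ twice e                ≡⟨ cong (x ⊙ x ⊕_) 2e≡e ⟩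
    x ⊙ x ⊕ e                      ≡⟨ ⊕-comm (x ⊙ x) e ⟩
    e ⊕ x ⊙ x                      ∎
    where open ≤-Reasoning

  2e≡e⇒e⊕x≤e∨x : ∀ {e} x → twice e ≡ e → e ⊕ x ≤ e ∨ x
  2e≡e⇒e⊕x≤e∨x {e} x 2e≡e = begin
    e ⊕ x                          ≡⟨ cong (e ⊕_) ([x∧y]⊕[x⊙¬y]≡x x e) ⟨
    e ⊕ (x ∧ e ⊕ x ⊙ ¬ e)          ≡⟨ ⊕-assoc e (x ∧ e) (x ⊙ ¬ e) ⟨
    e ⊕ x ∧ e ⊕ x ⊙ ¬ e            ≲⟨ ⊕-monoˡ-≤ (x ⊙ ¬ e) (⊕-monoʳ-≤ e x∧y≤y) ⟩
    twice e ⊕ x ⊙ ¬ e              ≡⟨ cong (_⊕ x ⊙ ¬ e) 2e≡e ⟩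
    e ⊕ x ⊙ ¬ e                    ≡⟨ ⊕-comm e (x ⊙ ¬ e) ⟩
    x ⊙ ¬ e ⊕ e                    ≡⟨ cong (λ t → ¬ (¬ x ⊕ t) ⊕ e) (¬-involutive e) ⟩
    x ∨ e                          ≡⟨ ∨-comm x e ⟩
    e ∨ x                          ∎
    where open ≤-Reasoning

  x²≡𝟘⇒y²≡𝟘⇒[x∨y]²≡𝟘 : ∀ {x y} → sq x ≡ 𝟘 → sq y ≡ 𝟘 → sq (x ∨ y) ≡ 𝟘
  x²≡𝟘⇒y²≡𝟘⇒[x∨y]²≡𝟘 {x} {y} x²≡𝟘 y²≡𝟘 = x≤¬x⇒x²≡𝟘
    (∨-lub (x≤¬y⇒y≤¬x (∨-lub x≤¬x (x≤¬y⇒y≤¬x x≤¬y)))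
           (x≤¬y⇒y≤¬x (∨-lub x≤¬y y≤¬y)))
    where
    x≤¬x : x ≤ ¬ x
    x≤¬x = x²≡𝟘⇒x≤¬x x²≡𝟘
    y≤¬y : y ≤ ¬ y
    y≤¬y = x²≡𝟘⇒x≤¬x y²≡𝟘
    x⊙y≡𝟘 : x ⊙ y ≡ 𝟘
    x⊙y≡𝟘 = x≤𝟘⇒x≡𝟘 (≤-trans (∧-glb ≤-refl (⊙-mono-≤ x≤¬x y≤¬y))
                              (≤-reflexive ([x⊙y]∧[¬x⊙¬y]≡𝟘 x y)))
    x≤¬y : x ≤ ¬ y
    x≤¬y = x⊙¬y≡𝟘⇒x≤y (trans (cong (x ⊙_) (¬-involutive y)) x⊙y≡𝟘)

module VCProperties {a : Level} (A : MVAlgebra a) (vc : InVC A) where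
  open MVAlgebra A
  open MVAlgebraProperties A
  open CommutativeSemigroupProperties ⊕-commutativeSemigroup using (interchange)

  ¬2x²≡2[¬x]² : ∀ x → ¬ twice (sq x) ≡ twice (sq (¬ x))
  ¬2x²≡2[¬x]² x = vc (¬ x)

  2x²∧¬2x²≡𝟘 : ∀ x → twice (sq x) ∧ (¬ twice (sq x)) ≡ 𝟘
  2x²∧¬2x²≡𝟘 x = trans (cong (twice (sq x) ∧_) (¬2x²≡2[¬x]² x))
                       (x∧y≡𝟘⇒2x∧2y≡𝟘 ([x⊙y]∧[¬x⊙¬y]≡𝟘 x x))

  [2x²]²≡2x² : ∀ x → sq (twice (sq x)) ≡ twice (sq x)
  [2x²]²≡2x² x = x∧¬x≡𝟘⇒x²≡x (2x²∧¬2x²≡𝟘 x)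

  [¬2x²]²≡¬2x² : ∀ x → sq (¬ twice (sq x)) ≡ ¬ twice (sq x)
  [¬2x²]²≡¬2x² x = begin
    sq (¬ twice (sq x))            ≡⟨ cong sq (¬2x²≡2[¬x]² x) ⟩
    sq (twice (sq (¬ x)))          ≡⟨ [2x²]²≡2x² (¬ x) ⟩
    twice (sq (¬ x))               ≡⟨ ¬2x²≡2[¬x]² x ⟨
    ¬ twice (sq x)                 ∎
    where open ≡-Reasoning

  2[2x²]≡2x² : ∀ x → twice (twice (sq x)) ≡ twice (sq x)
  2[2x²]≡2x² x = x∧¬x≡𝟘⇒2x≡x (2x²∧¬2x²≡𝟘 x)

  2x≡2x²⊕r : ∀ x → Σ[ r ∈ Carrier ] sq r ≡ 𝟘 × twice x ≡ twice (sq x) ⊕ r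
  2x≡2x²⊕r x = r , r²≡𝟘 , 2x≡b⊕r
    where
    b : Carrier
    b = twice (sq x)
    r : Carrier
    r = twice x ⊙ ¬ b
    b≤2x : b ≤ twice x
    b≤2x = subst (_≤ twice x) (vc x) x⊙y≤x
    r²≡𝟘 : sq r ≡ 𝟘
    r²≡𝟘 = x≤𝟘⇒x≡𝟘 (≤-trans (∧-glb r²≤b r²≤¬b) (≤-reflexive (2x²∧¬2x²≡𝟘 x)))
      where
      r²≤b : sq r ≤ b
      r²≤b = subst (sq r ≤_) (vc x) (sq-mono-≤ x⊙y≤x)
      r²≤¬b : sq r ≤ ¬ b
      r²≤¬b = subst (sq r ≤_) ([¬2x²]²≡¬2x² x) (sq-mono-≤ x⊙y≤y)
    2x≡b⊕r : twice x ≡ b ⊕ r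
    2x≡b⊕r = trans (sym ([x∧y]⊕[x⊙¬y]≡x (twice x) b))
                   (cong (_⊕ r) (≤-antisym x∧y≤y (∧-glb b≤2x ≤-refl)))

  x²≡𝟘⇒y²≡𝟘⇒[x⊕y]²≡𝟘 : ∀ {x y} → sq x ≡ 𝟘 → sq y ≡ 𝟘 → sq (x ⊕ y) ≡ 𝟘
  x²≡𝟘⇒y²≡𝟘⇒[x⊕y]²≡𝟘 {x} {y} x²≡𝟘 y²≡𝟘 = x≤𝟘⇒x≡𝟘 (begin
    sq (x ⊕ y)                     ≲⟨ sq-mono-≤ (⊕-mono-≤ x≤x∨y y≤x∨y) ⟩
    sq (twice (x ∨ y))             ≡⟨ vc (x ∨ y) ⟩
    twice (sq (x ∨ y))             ≡⟨ cong twice (x²≡𝟘⇒y²≡𝟘⇒[x∨y]²≡𝟘 x²≡𝟘 y²≡𝟘) ⟩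
    𝟘 ⊕ 𝟘                          ≡⟨ ⊕-identityʳ 𝟘 ⟩
    𝟘                              ∎)
    where open ≤-Reasoning

  2[x⊕y]²≤2x²⊕2y² : ∀ x y → twice (sq (x ⊕ y)) ≤ twice (sq x) ⊕ twice (sq y)
  2[x⊕y]²≤2x²⊕2y² x y =
    let r , r²≡𝟘 , 2x≡bx⊕r = 2x≡2x²⊕r x
        s , s²≡𝟘 , 2y≡by⊕s = 2x≡2x²⊕r y
    in begin
    twice (sq (x ⊕ y))             ≡⟨ vc (x ⊕ y) ⟨
    sq (twice (x ⊕ y))             ≡⟨ cong sq (interchange x y x y) ⟩
    sq (twice x ⊕ twice y)         ≡⟨ cong sq (cong₂ _⊕_ 2x≡bx⊕r 2y≡by⊕s) ⟩
    sq ((bx ⊕ r) ⊕ (by ⊕ s))       ≡⟨ cong sq (interchange bx r by s) ⟩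
    sq ((bx ⊕ by) ⊕ (r ⊕ s))       ≲⟨ 2e≡e⇒[e⊕x]²≤e⊕x² (r ⊕ s) 2[bx⊕by]≡bx⊕by ⟩
    (bx ⊕ by) ⊕ sq (r ⊕ s)         ≡⟨ cong ((bx ⊕ by) ⊕_) (x²≡𝟘⇒y²≡𝟘⇒[x⊕y]²≡𝟘 r²≡𝟘 s²≡𝟘) ⟩
    (bx ⊕ by) ⊕ 𝟘                  ≡⟨ ⊕-identityʳ (bx ⊕ by) ⟩
    bx ⊕ by                        ∎
    where
    open ≤-Reasoning
    bx : Carrier
    bx = twice (sq x)
    by : Carrier
    by = twice (sq y)
    2[bx⊕by]≡bx⊕by : twice (bx ⊕ by) ≡ bx ⊕ by
    2[bx⊕by]≡bx⊕by = trans (interchange bx by bx by) (cong₂ _⊕_ (2[2x²]≡2x² x) (2[2x²]≡2x² y))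

  θ-⊕ : ∀ {x y} → θ x → θ y → θ (x ⊕ y)
  θ-⊕ {x} {y} θx θy = ≤-trans (2[x⊕y]²≤2x²⊕2y² x y) (⊕-mono-≤ θx θy)

  θ-⊙ : ∀ {x y} → θ x → θ y → θ (x ⊙ y)
  θ-⊙ {x} {y} θx θy = begin
    twice (sq (x ⊙ y))                       ≡⟨ [2x²]²≡2x² (x ⊙ y) ⟨
    sq (twice (sq (x ⊙ y)))                  ≲⟨ ⊙-mono-≤ (2x²-mono-≤ x⊙y≤x) (2x²-mono-≤ x⊙y≤y) ⟩
    twice (sq x) ⊙ twice (sq y)              ≲⟨ ⊙-mono-≤ θx θy ⟩
    x ⊙ y                                    ∎
    where open ≤-Reasoning

  θ-∧ : ∀ {x y} → θ x → θ y → θ (x ∧ y)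
  θ-∧ θx θy = ∧-glb (≤-trans (2x²-mono-≤ x∧y≤x) θx) (≤-trans (2x²-mono-≤ x∧y≤y) θy)

  θ-∨ : ∀ {x y} → θ x → θ y → θ (x ∨ y)
  θ-∨ {x} {y} θx θy = begin
    twice (sq (x ∨ y))                       ≲⟨ 2x²-mono-≤ x∨y≤x⊕y ⟩
    twice (sq (x ⊕ y))                       ≲⟨ 2[x⊕y]²≤2x²⊕2y² x y ⟩
    twice (sq x) ⊕ twice (sq y)              ≲⟨ 2e≡e⇒e⊕x≤e∨x (twice (sq y)) (2[2x²]≡2x² x) ⟩
    twice (sq x) ∨ twice (sq y)              ≲⟨ ∨-mono-≤ θx θy ⟩
    x ∨ y                                    ∎
    where open ≤-Reasoning

mainTheorem4 : ∀ {a : Level} (A : MVAlgebra a) → InVC A →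
    let open MVAlgebra A in
    ∀ x y → θ x → θ y →
      θ (x ⊕ y) × θ (x ⊙ y) × θ (x ∧ y) × θ (x ∨ y)
mainTheorem4 A vc x y θx θy = θ-⊕ θx θy , θ-⊙ θx θy , θ-∧ θx θy , θ-∨ θx θy
  where open VCProperties A vc
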